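{- Let $G$ be a vertex-transitive simple graph of order $n$, let $w$ be any vertex of $G$, and let $k$ be an integer with $2\le k\le n-2$. Then \[\beta(F_k(G))\le\min\Big\{\frac nk\,\beta\big(F_{k-1}(G-w)\big),\ \frac{n}{n-k}\,\beta\big(F_k(G-w)\big)\Big\}.\]
   Context: For a simple finite graph $H$ of order $N$ and an integer $1\le k\le N-1$, the $k$-token graph $F_k(H)$ is the graph whose vertices are all $k$-element subsets of $V(H)$, two such subsets being adjacent iff their symmetric difference is an edge of $H$. $\beta$ denotes the independence number; $G-w$ is $G$ with vertex $w$ deleted. -}

module Defs where

open import Level using (0ℓ)
open import Data.Nat using (ℕ)
open import Data.Fin using (Fin; punchIn)
open import Data.Fin.Subset using (Subset; _∈_; _∉_; ∣_∣)
open import Data.Product using (Σ; ∃; ∃-syntax; _×_; proj₁)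
open import Data.List using (List; length)
open import Data.List.Relation.Unary.AllPairs using (AllPairs)
open import Data.List.Relation.Unary.Unique.Propositional using (Unique)
open import Function.Bundles using (_↔_; Inverse)
open import Function.Bundles using (_⇔_)
open import Relation.Binary.PropositionalEquality using (_≡_; _≢_)
open import Relation.Nullary using (¬_)

record SimpleGraph (n : ℕ) : Set₁ where
  field
    Adj    : Fin n → Fin n → Set
    sym    : ∀ {x y} → Adj x y → Adj y x
    irrefl : ∀ {x} → ¬ Adj x x
open SimpleGraph public

IsAutomorphism : ∀ {n} → SimpleGraph n → (Fin n ↔ Fin n) → Set
IsAutomorphism G σ = ∀ x y → (Adj G x y ⇔ Adj G (Inverse.to σ x) (Inverse.to σ y))

VertexTransitive : ∀ {n} → SimpleGraph n → Set
VertexTransitive {n} G =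
  ∀ (u v : Fin n) → Σ (Fin n ↔ Fin n) λ σ → IsAutomorphism G σ × Inverse.to σ u ≡ v

deleteVertex : ∀ {m} → SimpleGraph (Data.Nat.suc m) → Fin (Data.Nat.suc m) → SimpleGraph m
deleteVertex G w = record
  { Adj    = λ i j → Adj G (punchIn w i) (punchIn w j)
  ; sym    = sym G
  ; irrefl = irrefl G
  }

TokenVertex : ℕ → ℕ → Set
TokenVertex n k = Σ (Subset n) λ S → ∣ S ∣ ≡ k

TokenAdj : ∀ {n} → SimpleGraph n → (k : ℕ) → TokenVertex n k → TokenVertex n k → Set
TokenAdj {n} G k A B =
  ∃[ a ] ∃[ b ] ( Adj G a b
                × a ∈ proj₁ A × a ∉ proj₁ B
                × b ∈ proj₁ B × b ∉ proj₁ A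
                × (∀ (x : Fin n) → x ≢ a → x ≢ b → (x ∈ proj₁ A ⇔ x ∈ proj₁ B)) )

IsIndependent : {V : Set} → (V → V → Set) → List V → Set
IsIndependent Adj' I = Unique I × AllPairs (λ x y → ¬ Adj' x y × ¬ Adj' y x) I

IsIndependenceNumber : {V : Set} → (V → V → Set) → ℕ → Set
IsIndependenceNumber {V} Adj' b =
  (Σ (List V) λ I → IsIndependent Adj' I × length I ≡ b)
  × (∀ (I : List V) → IsIndependent Adj' I → length I Data.Nat.≤ b)

IsTokenIndependenceNumber : ∀ {n} → SimpleGraph n → ℕ → ℕ → Set
IsTokenIndependenceNumber G k b = IsIndependenceNumber (TokenAdj G k) b

-- Let I be a maximum independent set of F_k(G), n = |G|. Counting pairs (x, A) with A ∈ I,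
-- the members of I containing a vertex x total k·|I| over all x, and those avoiding x total
-- (n − k)·|I|; so some vertex v lies in at least k·|I|/n members of I (resp. avoids at least
-- (n − k)·|I|/n of them). An automorphism σ with σ v = w moves these members to sets that all
-- contain (resp. avoid) w. Deleting w from them gives distinct (k − 1)-sets (resp. k-sets) of
-- G − w, and two of them adjacent in the token graph of G − w would make the original sets
-- adjacent in F_k(G); so they are independent there.
module Submission where

open import Defs hiding (sym)
open import Data.Nat using (ℕ; zero; suc; _+_; _*_; _∸_; _≤_; z≤n; _≤?_)
open import Data.Nat.Properties
open import Data.Bool using (Bool; true; false) renaming (_≟_ to _≟ᵇ_)
open import Data.Fin using (Fin; punchIn; punchOut) renaming (zero to fzero; suc to fsuc; _≟_ to _≟ᶠ_)
open import Data.Fin.Properties using (any?; punchIn-punchOut)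
open import Data.Fin.Subset using (Subset; ∣_∣; _∈_)
open import Data.Fin.Permutation using (Permutation′; _⟨$⟩ʳ_; _⟨$⟩ˡ_; flip; inverseˡ; inverseʳ)
open import Data.Vec using ([]; _∷_; lookup; tabulate)
open import Data.Vec.Properties using (lookup∘tabulate; tabulate∘lookup; tabulate-cong; []=⇒lookup; lookup⇒[]=)
open import Data.List using (List; []; _∷_; length)
open import Data.List.Relation.Unary.All using (All; []; _∷_)
open import Data.List.Relation.Unary.AllPairs using (AllPairs; []; _∷_)
open import Data.Product using (∃; _×_; _,_; proj₁)
open import Data.Empty using (⊥-elim)
open import Function using (_∘_)
open import Function.Bundles using (_⇔_; mk⇔; Equivalence)
import Function.Properties.Equivalence as ⇔
open import Relation.Binary.PropositionalEquality
open import Relation.Nullary using (yes; no; Dec)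
open import Algebra.Properties.Semiring.Sum +-*-semiring
  using (sum; sum-cong-≗; ∑-distrib-+; *-distribˡ-sum; sum-remove; sum-permute)

sum-const : ∀ n c → sum {n} (λ _ → c) ≡ n * c
sum-const zero    c = refl
sum-const (suc n) c = cong (c +_) (sum-const n c)

sum-mono-≤ : ∀ {n} {f g : Fin n → ℕ} → (∀ i → f i ≤ g i) → sum f ≤ sum g
sum-mono-≤ {zero}  f≤g = z≤n
sum-mono-≤ {suc n} f≤g = +-mono-≤ (f≤g fzero) (sum-mono-≤ (f≤g ∘ fsuc))

pigeonhole : ∀ {m} (f : Fin (suc m) → ℕ) → ∃ λ i → sum f ≤ suc m * f i
pigeonhole {m} f with any? (λ i → sum f ≤? suc m * f i)
... | yes found = found
... | no  none  = ⊥-elim (m+n≮n (m * 1) (n * sum f) (begin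
    n * 1 + n * sum f                       ≡⟨ cong₂ _+_ (sym (sum-const n 1)) (*-distribˡ-sum n f) ⟩
    sum {n} (λ _ → 1) + sum (λ i → n * f i) ≡⟨ ∑-distrib-+ (λ _ → 1) (λ i → n * f i) ⟨
    sum (λ i → suc (n * f i))               ≤⟨ sum-mono-≤ (λ i → ≰⇒> (λ ≤nfi → none (i , ≤nfi))) ⟩
    sum {n} (λ _ → sum f)                   ≡⟨ sum-const n (sum f) ⟩
    n * sum f                               ∎))
  where
  n = suc m
  open ≤-Reasoning

δ : Bool → Bool → ℕ
δ true  true  = 1
δ true  false = 0
δ false true  = 0
δ false false = 1

δ-≡ : ∀ {s b} → b ≡ s → δ s b ≡ 1
δ-≡ {true}  refl = refl
δ-≡ {false} refl = refl

δ-≢ : ∀ {s b} → b ≢ s → δ s b ≡ 0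
δ-≢ {true}  {true}  b≢s = ⊥-elim (b≢s refl)
δ-≢ {true}  {false} b≢s = refl
δ-≢ {false} {true}  b≢s = refl
δ-≢ {false} {false} b≢s = ⊥-elim (b≢s refl)

δ-false+δ-true : ∀ b → δ false b + δ true b ≡ 1
δ-false+δ-true true  = refl
δ-false+δ-true false = refl

∣S∣≡∑δ : ∀ {n} (S : Subset n) → ∣ S ∣ ≡ sum (δ true ∘ lookup S)
∣S∣≡∑δ []          = refl
∣S∣≡∑δ (true  ∷ S) = cong suc (∣S∣≡∑δ S)
∣S∣≡∑δ (false ∷ S) = ∣S∣≡∑δ S

fibreSize : ℕ → ℕ → Bool → ℕ
fibreSize n k true  = k
fibreSize n k false = n ∸ k

∑δ≡fibreSize : ∀ {n k} s (S : Subset n) → ∣ S ∣ ≡ k → sum (δ s ∘ lookup S) ≡ fibreSize n k s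
∑δ≡fibreSize true  S ∣S∣≡k = trans (sym (∣S∣≡∑δ S)) ∣S∣≡k
∑δ≡fibreSize {n} {k} false S ∣S∣≡k = begin
  sum (δ false ∘ lookup S)                 ≡⟨ m+n∸n≡m _ k ⟨
  sum (δ false ∘ lookup S) + k ∸ k         ≡⟨ cong (λ t → sum (δ false ∘ lookup S) + t ∸ k) (trans (sym ∣S∣≡k) (∣S∣≡∑δ S)) ⟩
  sum (δ false ∘ lookup S) + sum (δ true ∘ lookup S) ∸ k
    ≡⟨ cong (_∸ k) (∑-distrib-+ (δ false ∘ lookup S) (δ true ∘ lookup S)) ⟨
  sum (λ x → δ false (lookup S x) + δ true (lookup S x)) ∸ k
    ≡⟨ cong (_∸ k) (trans (sum-cong-≗ (δ-false+δ-true ∘ lookup S)) (sum-const n 1)) ⟩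
  n * 1 ∸ k                                ≡⟨ cong (_∸ k) (*-identityʳ n) ⟩
  n ∸ k                                    ∎
  where open ≡-Reasoning

countAt : ∀ {n k} → Bool → Fin n → List (TokenVertex n k) → ℕ
countAt s x []      = 0
countAt s x (A ∷ I) = δ s (lookup (proj₁ A) x) + countAt s x I

∑countAt : ∀ {n k} s (I : List (TokenVertex n k)) → sum (λ x → countAt s x I) ≡ fibreSize n k s * length I
∑countAt {n} {k} s [] = trans (sum-const n 0) (trans (*-zeroʳ n) (sym (*-zeroʳ (fibreSize n k s))))
∑countAt {n} {k} s ((A , ∣A∣≡k) ∷ I) = begin
  sum (λ x → δ s (lookup A x) + countAt s x I)
    ≡⟨ ∑-distrib-+ (δ s ∘ lookup A) (λ x → countAt s x I) ⟩
  sum (δ s ∘ lookup A) + sum (λ x → countAt s x I)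
    ≡⟨ cong₂ _+_ (∑δ≡fibreSize s A ∣A∣≡k) (∑countAt s I) ⟩
  fibreSize n k s + fibreSize n k s * length I
    ≡⟨ *-suc (fibreSize n k s) (length I) ⟨
  fibreSize n k s * suc (length I) ∎
  where open ≡-Reasoning

module _ {V W : Set} {P : V → Set} (P? : ∀ x → Dec (P x)) (f : ∀ x → P x → W) where

  filterMap : List V → List W
  filterMap []       = []
  filterMap (x ∷ xs) with P? x
  ... | yes px = f x px ∷ filterMap xs
  ... | no  _  = filterMap xs

  All-filterMap : {R : V → Set} {R′ : W → Set} → (∀ {x} (px : P x) → R x → R′ (f x px)) →
                  ∀ {xs} → All R xs → All R′ (filterMap xs)
  All-filterMap R⇒R′ {[]}     []       = []
  All-filterMap R⇒R′ {x ∷ xs} (r ∷ rs) with P? x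
  ... | yes px = R⇒R′ px r ∷ All-filterMap R⇒R′ rs
  ... | no  _  = All-filterMap R⇒R′ rs

  AllPairs-filterMap : {R : V → V → Set} {R′ : W → W → Set} →
                       (∀ {x y} (px : P x) (py : P y) → R x y → R′ (f x px) (f y py)) →
                       ∀ {xs} → AllPairs R xs → AllPairs R′ (filterMap xs)
  AllPairs-filterMap R⇒R′ {[]}     []       = []
  AllPairs-filterMap R⇒R′ {x ∷ xs} (r ∷ rs) with P? x
  ... | yes px = All-filterMap (R⇒R′ px) r ∷ AllPairs-filterMap R⇒R′ rs
  ... | no  _  = AllPairs-filterMap R⇒R′ rs

TokenVertex-≡ : ∀ {n k} {A B : TokenVertex n k} → proj₁ A ≡ proj₁ B → A ≡ B
TokenVertex-≡ {A = S , p} {B = .S , q} refl = cong (S ,_) (≡-irrelevant p q)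

lookup≡⇒∈⇔ : ∀ {n n′} {x : Fin n} {y : Fin n′} {S S′} → lookup S x ≡ lookup S′ y → (x ∈ S ⇔ y ∈ S′)
lookup≡⇒∈⇔ {x = x} {y} {S} {S′} Sx≡S′y = mk⇔
  (λ x∈S  → lookup⇒[]= y S′ (trans (sym Sx≡S′y) ([]=⇒lookup x∈S)))
  (λ y∈S′ → lookup⇒[]= x S (trans Sx≡S′y ([]=⇒lookup y∈S′)))

-- ι = π ∘ punchIn w enumerates every vertex of Fin (suc m) except v = π w.
module Restriction {m} (π : Permutation′ (suc m)) (w v : Fin (suc m)) (πw≡v : π ⟨$⟩ʳ w ≡ v) where

  ι : Fin m → Fin (suc m)
  ι j = π ⟨$⟩ʳ punchIn w j

  ι-elim : ∀ {P : Fin (suc m) → Set} → P v → (∀ j → P (ι j)) → ∀ x → P x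
  ι-elim {P} Pv Pι x with x ≟ᶠ v
  ... | yes refl = Pv
  ... | no  x≢v  = subst P (trans (cong (π ⟨$⟩ʳ_) (punchIn-punchOut w≢π⁻¹x)) (inverseʳ π)) (Pι (punchOut w≢π⁻¹x))
    where
    w≢π⁻¹x : w ≢ π ⟨$⟩ˡ x
    w≢π⁻¹x w≡π⁻¹x = x≢v (trans (sym (inverseʳ π)) (trans (cong (π ⟨$⟩ʳ_) (sym w≡π⁻¹x)) πw≡v))

  restrict : Subset (suc m) → Subset m
  restrict A = tabulate (lookup A ∘ ι)

  lookup-restrict : ∀ A j → lookup (restrict A) j ≡ lookup A (ι j)
  lookup-restrict A = lookup∘tabulate (lookup A ∘ ι)

  ∈-restrict⇔ : ∀ A j → (j ∈ restrict A ⇔ ι j ∈ A)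
  ∈-restrict⇔ A j = lookup≡⇒∈⇔ (lookup-restrict A j)

  ∣A∣≡δ+∣restrict∣ : ∀ A → ∣ A ∣ ≡ δ true (lookup A v) + ∣ restrict A ∣
  ∣A∣≡δ+∣restrict∣ A = begin
    ∣ A ∣                                          ≡⟨ ∣S∣≡∑δ A ⟩
    sum (δ true ∘ lookup A)                        ≡⟨ sum-permute (δ true ∘ lookup A) π ⟩
    sum (δ true ∘ lookup A ∘ (π ⟨$⟩ʳ_))            ≡⟨ sum-remove {i = w} (δ true ∘ lookup A ∘ (π ⟨$⟩ʳ_)) ⟩
    δ true (lookup A (π ⟨$⟩ʳ w)) + sum (δ true ∘ lookup A ∘ ι)
      ≡⟨ cong₂ _+_ (cong (δ true ∘ lookup A) πw≡v)
                   (sum-cong-≗ (λ j → cong (δ true) (sym (lookup-restrict A j)))) ⟩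
    δ true (lookup A v) + sum (δ true ∘ lookup (restrict A)) ≡⟨ cong (_ +_) (∣S∣≡∑δ (restrict A)) ⟨
    δ true (lookup A v) + ∣ restrict A ∣           ∎
    where open ≡-Reasoning

  restrict-injective : ∀ {A B} → lookup A v ≡ lookup B v → restrict A ≡ restrict B → A ≡ B
  restrict-injective {A} {B} Av≡Bv rA≡rB = begin
    A                  ≡⟨ tabulate∘lookup A ⟨
    tabulate (lookup A) ≡⟨ tabulate-cong (ι-elim Av≡Bv Aι≡Bι) ⟩
    tabulate (lookup B) ≡⟨ tabulate∘lookup B ⟩
    B                  ∎
    where
    open ≡-Reasoning
    Aι≡Bι : ∀ j → lookup A (ι j) ≡ lookup B (ι j)
    Aι≡Bι j = trans (sym (lookup-restrict A j))
                    (trans (cong (λ S → lookup S j) rA≡rB) (lookup-restrict B j))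

  module _ (G : SimpleGraph (suc m)) (H : SimpleGraph m) (ι-hom : ∀ {i j} → Adj H i j → Adj G (ι i) (ι j)) where

    module Fibre (k : ℕ) (s : Bool) where

      restrictToken : ∀ A → lookup (proj₁ A) v ≡ s → TokenVertex m (k ∸ δ true s)
      restrictToken (A , ∣A∣≡k) Av≡s = restrict A , (begin
        ∣ restrict A ∣                                    ≡⟨ m+n∸m≡n (δ true s) _ ⟨
        δ true s + ∣ restrict A ∣ ∸ δ true s              ≡⟨ cong (λ b → δ true b + ∣ restrict A ∣ ∸ δ true s) Av≡s ⟨
        δ true (lookup A v) + ∣ restrict A ∣ ∸ δ true s   ≡⟨ cong (_∸ δ true s) (trans (sym (∣A∣≡δ+∣restrict∣ A)) ∣A∣≡k) ⟩
        k ∸ δ true s                                      ∎)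
        where open ≡-Reasoning

      TokenAdj-restrictToken⇒TokenAdj :
        ∀ A B (Av≡s : lookup (proj₁ A) v ≡ s) (Bv≡s : lookup (proj₁ B) v ≡ s) →
        TokenAdj H (k ∸ δ true s) (restrictToken A Av≡s) (restrictToken B Bv≡s) → TokenAdj G k A B
      TokenAdj-restrictToken⇒TokenAdj (A , _) (B , _) Av≡s Bv≡s
                                      (a , b , adj , a∈ , a∉ , b∈ , b∉ , others) =
        ι a , ι b , ι-hom adj ,
        to (∈-restrict⇔ A a) a∈ , a∉ ∘ from (∈-restrict⇔ B a) ,
        to (∈-restrict⇔ B b) b∈ , b∉ ∘ from (∈-restrict⇔ A b) ,
        ι-elim (λ _ _ → lookup≡⇒∈⇔ (trans Av≡s (sym Bv≡s))) others′
        where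
        open Equivalence
        others′ : ∀ j → ι j ≢ ι a → ι j ≢ ι b → (ι j ∈ A ⇔ ι j ∈ B)
        others′ j ιj≢ιa ιj≢ιb = ⇔.trans (⇔.sym (∈-restrict⇔ A j))
          (⇔.trans (others j (ιj≢ιa ∘ cong ι) (ιj≢ιb ∘ cong ι)) (∈-restrict⇔ B j))

      restrictFibre : List (TokenVertex (suc m) k) → List (TokenVertex m (k ∸ δ true s))
      restrictFibre = filterMap (λ A → lookup (proj₁ A) v ≟ᵇ s) restrictToken

      length-restrictFibre : ∀ I → length (restrictFibre I) ≡ countAt s v I
      length-restrictFibre []      = refl
      length-restrictFibre (A ∷ I) with lookup (proj₁ A) v ≟ᵇ s
      ... | yes Av≡s = cong₂ _+_ (sym (δ-≡ Av≡s)) (length-restrictFibre I)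
      ... | no  Av≢s = trans (length-restrictFibre I) (sym (cong (_+ countAt s v I) (δ-≢ Av≢s)))

      restrictFibre-independent : ∀ {I} → IsIndependent (TokenAdj G k) I →
                                  IsIndependent (TokenAdj H (k ∸ δ true s)) (restrictFibre I)
      restrictFibre-independent (unique , nonadjacent) =
        AllPairs-filterMap _ restrictToken
          (λ {A} {B} Av≡s Bv≡s A≢B rA≡rB →
             A≢B (TokenVertex-≡ (restrict-injective (trans Av≡s (sym Bv≡s)) (cong proj₁ rA≡rB))))
          unique ,
        AllPairs-filterMap _ restrictToken
          (λ {A} {B} Av≡s Bv≡s (¬A~B , ¬B~A) →
             (λ rA~rB → ¬A~B (TokenAdj-restrictToken⇒TokenAdj A B Av≡s Bv≡s rA~rB)) ,
             (λ rB~rA → ¬B~A (TokenAdj-restrictToken⇒TokenAdj B A Bv≡s Av≡s rB~rA)))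
          nonadjacent

automorphism⁻¹-hom : ∀ {n} {G : SimpleGraph n} {σ : Permutation′ n} → IsAutomorphism G σ →
                     ∀ {x y} → Adj G x y → Adj G (σ ⟨$⟩ˡ x) (σ ⟨$⟩ˡ y)
automorphism⁻¹-hom {G = G} {σ} aut x~y =
  Equivalence.from (aut _ _) (subst₂ (Adj G) (sym (inverseʳ σ)) (sym (inverseʳ σ)) x~y)

fibre-independence-bound :
  ∀ {m} (G : SimpleGraph (suc m)) → VertexTransitive G → ∀ w k s {b} →
  (∀ J → IsIndependent (TokenAdj (deleteVertex G w) (k ∸ δ true s)) J → length J ≤ b) →
  ∀ I → IsIndependent (TokenAdj G k) I → fibreSize (suc m) k s * length I ≤ suc m * b
fibre-independence-bound {m} G vt w k s {b} β-max I I-independent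
  with pigeonhole (λ x → countAt s x I)
... | v , ∑count≤ with vt v w
... | σ , aut , σv≡w = begin
  fibreSize (suc m) k s * length I     ≡⟨ ∑countAt s I ⟨
  sum (λ x → countAt s x I)            ≤⟨ ∑count≤ ⟩
  suc m * countAt s v I                ≡⟨ cong (suc m *_) (length-restrictFibre I) ⟨
  suc m * length (restrictFibre I)     ≤⟨ *-monoʳ-≤ (suc m) (β-max _ (restrictFibre-independent I-independent)) ⟩
  suc m * b                            ∎
  where
  open ≤-Reasoning
  σ⁻¹w≡v : flip σ ⟨$⟩ʳ w ≡ v
  σ⁻¹w≡v = trans (cong (σ ⟨$⟩ˡ_) (sym σv≡w)) (inverseˡ σ)
  open Restriction (flip σ) w v σ⁻¹w≡v
  open Fibre G (deleteVertex G w) (automorphism⁻¹-hom {G = G} {σ} aut) k s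

corollary5p3 : (m : ℕ) → (G : SimpleGraph (suc m)) → VertexTransitive G →
    (w : Fin (suc m)) → (k : ℕ) → 2 ≤ k → k + 2 ≤ suc m →
    (b₀ b₁ b₂ : ℕ) →
    IsTokenIndependenceNumber G k b₀ →
    IsTokenIndependenceNumber (deleteVertex G w) (k ∸ 1) b₁ →
    IsTokenIndependenceNumber (deleteVertex G w) k b₂ →
    (k * b₀ ≤ suc m * b₁) × ((suc m ∸ k) * b₀ ≤ suc m * b₂)
corollary5p3 m G vt w k _ _ b₀ b₁ b₂ ((I , I-independent , ∣I∣≡b₀) , _) (_ , β₁-max) (_ , β₂-max) =
  subst (λ b → k * b ≤ suc m * b₁) ∣I∣≡b₀
        (fibre-independence-bound G vt w k true β₁-max I I-independent) ,
  subst (λ b → (suc m ∸ k) * b ≤ suc m * b₂) ∣I∣≡b₀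
        (fibre-independence-bound G vt w k false β₂-max I I-independent)
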